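{- Fix $k\ge2$. For all $n\ge0$, $$\sum_{m=0}^n D^{k,k-1}_{n,m}=M^{k-1}_{n,0}(\vec\alpha',\vec\alpha),$$ where $\vec\alpha=(\alpha_0,\dots,\alpha_{k-2})$ with $\alpha_i=\binom{k}{i+1}$ for $0\le i\le k-2$, and $\vec\alpha'=(k+1,\alpha_1,\dots,\alpha_{k-2})$ (i.e. $\alpha'_0=k+1$ and $\alpha'_i=\binom{k}{i+1}$ for $1\le i\le k-2$).
   Context: For $k\ge2$ and $a\ge0$, $D^{k,a}_{n,m}$ is the number of integer lattice paths from $(0,0)$ to $(kn,km)$ using steps $U=(1,1)$ and $(1,1-k)$ that stay weakly above the line $y=-a$. An order-$\ell$ Motzkin path of length $n$ and height $m$ is an integer lattice path from $(0,0)$ to $(n,m)$ using steps $U=(1,1)$ and $D_i=(1,-i)$ for $0\le i\le \ell$, never going below $y=0$. For $\ell$-tuples of non-negative integers $\vec\alpha=(\alpha_0,\dots,\alpha_{\ell-1}),\vec\beta=(\beta_0,\dots,\beta_{\ell-1})$, an $(\vec\alpha,\vec\beta)$-colored Motzkin path is such a path in which, for each $0\le i\le \ell-1$, each $D_i$ step whose right endpoint is at height $0$ is labeled by one of $\alpha_i$ colors and each $D_i$ step whose right endpoint is at height $>0$ is labeled by one of $\beta_i$ colors; $U$ and $D_\ell$ steps are unlabeled. $M^\ell_{n,m}(\vec\alpha,\vec\beta)$ is the number of such colored paths of length $n$ and height $m$. -}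

module Defs where

open import Data.Bool using (Bool; true; false; _∧_; if_then_else_)
open import Data.Nat as ℕ using (ℕ; zero; suc; _∸_)
open import Data.Nat.Combinatorics using (_C_)
open import Data.Integer as ℤ using (ℤ; +_; -_; _≤ᵇ_)
open import Data.Fin as Fin using (Fin; toℕ)
open import Data.List using (List; []; _∷_; map; concatMap; allFin)
open import Data.Nat.ListAction using (sum)
open import Relation.Nullary.Decidable using (does)

allWords : {A : Set} → List A → ℕ → List (List A)
allWords as zero    = [] ∷ []
allWords as (suc L) = concatMap (λ a → map (a ∷_) (allWords as L)) as

sumTo : ℕ → (ℕ → ℕ) → ℕ
sumTo zero    f = f 0
sumTo (suc n) f = sumTo n f ℕ.+ f (suc n)

infix 4 _==ℤ_
_==ℤ_ : ℤ → ℤ → Bool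
x ==ℤ y = does (x ℤ.≟ y)

data DStep : Set where
  up down : DStep

dSteps : List DStep
dSteps = up ∷ down ∷ []

dMove : ℕ → DStep → ℤ → ℤ
dMove k up   h = h ℤ.+ + 1
dMove k down h = h ℤ.+ (+ 1 ℤ.- + k)

dValid : (k a : ℕ) → ℤ → ℤ → List DStep → Bool
dValid k a h t []       = h ==ℤ t
dValid k a h t (s ∷ ss) = ((- (+ a)) ≤ᵇ dMove k s h) ∧ dValid k a (dMove k s h) t ss

D : (k a n m : ℕ) → ℕ
D k a n m = sum (map (λ w → if dValid k a (+ 0) (+ (k ℕ.* m)) w then 1 else 0)
                     (allWords dSteps (k ℕ.* n)))

-- Colored order-ℓ Motzkin paths.
-- Steps: U = (1,1), D_i = (1,-i) for 0 ≤ i ≤ ℓ.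
-- D_i for 0 ≤ i ≤ ℓ-1 is  Dc i  (i : Fin ℓ, colored); D_ℓ is  Dl  (uncolored).

data MStep (ℓ : ℕ) : Set where
  U  : MStep ℓ
  Dc : Fin ℓ → MStep ℓ
  Dl : MStep ℓ

mSteps : (ℓ : ℕ) → List (MStep ℓ)
mSteps ℓ = U ∷ Dl ∷ map Dc (allFin ℓ)

mMove : (ℓ : ℕ) → MStep ℓ → ℤ → ℤ
mMove ℓ U      h = h ℤ.+ + 1
mMove ℓ (Dc i) h = h ℤ.- + toℕ i
mMove ℓ Dl     h = h ℤ.- + ℓ

mColors : (ℓ : ℕ) → (α β : Fin ℓ → ℕ) → MStep ℓ → ℤ → ℕ
mColors ℓ α β U      h' = 1
mColors ℓ α β Dl     h' = 1
mColors ℓ α β (Dc i) h' = if h' ==ℤ (+ 0) then α i else β i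

mWeight : (ℓ : ℕ) → (α β : Fin ℓ → ℕ) → ℤ → ℤ → List (MStep ℓ) → ℕ
mWeight ℓ α β h t []       = if h ==ℤ t then 1 else 0
mWeight ℓ α β h t (s ∷ ss) =
  if + 0 ≤ᵇ mMove ℓ s h
  then mColors ℓ α β s (mMove ℓ s h) ℕ.* mWeight ℓ α β (mMove ℓ s h) t ss
  else 0

M : (ℓ n m : ℕ) → (α β : Fin ℓ → ℕ) → ℕ
M ℓ n m α β = sum (map (mWeight ℓ α β (+ 0) (+ m)) (allWords (mSteps ℓ) n))

alphaVec : (k : ℕ) → Fin (k ∸ 1) → ℕ
alphaVec k i = k C suc (toℕ i)

alphaVec' : (k : ℕ) → Fin (k ∸ 1) → ℕ
alphaVec' k i with toℕ i
... | zero  = suc k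
... | suc j = k C suc (suc j)

module Submission where

-- Cut a path counted by D into blocks of k steps. A block starting at height k h with d down
-- steps ends at height k (h + 1 − d), and when that is ≥ 0 all (k C d) orders of its steps stay
-- weakly above −(k − 1). So A n h, the number of paths of n blocks from height k h to any
-- height k m, satisfies A (n + 1) h = Σ_d (k C d) A n (h + 1 − d). Splitting off the first step,
-- the weight B n h of colored Motzkin paths of length n from height h to 0 satisfies the same
-- recursion (U, D_i and D_{k−1} lower the shifted height h + 1 by d = 0, i + 1 and k, with
-- 1, (k C (i + 1)) and 1 colors) plus the term [h = 0] B n 0 from the extra color of D₀ at
-- height 0. As convolution commutes with prefix sums and (k C 0) = 1, that extra term makes
-- A n h = Σ_{y ≤ h} B n y propagate from n to n + 1; at h = 0 this is the theorem.

open import Data.Bool using (Bool; true; false; _∧_; if_then_else_)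
open import Data.Bool.Properties using (T-≡; if-eta)
open import Data.Fin as Fin using (Fin; toℕ)
open import Data.Integer as ℤ using (ℤ; +_; -[1+_]; _⊖_)
import Data.Integer.Properties as ℤ
open import Data.List using (List; []; _∷_; _++_; map; concatMap; tabulate; allFin)
open import Data.List.Properties using (map-++; map-∘; map-cong; map-tabulate; tabulate-cong)
open import Data.Nat
open import Data.Nat.Combinatorics using (_C_; k>n⇒nCk≡0; nCk+nC[k+1]≡[n+1]C[k+1]; nCn≡1; nC1≡n)
open import Data.Nat.ListAction using (sum)
open import Data.Nat.ListAction.Properties using (sum-++)
open import Data.Nat.Properties
open import Data.Nat.Solver using (module +-*-Solver)
open import Function using (_∘_)
open import Function.Bundles using (Equivalence)
open import Relation.Binary.PropositionalEquality
open import Relation.Nullary.Decidable using (dec-true; dec-false)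

open import Defs

open ≡-Reasoning

sumTo-cong : ∀ N {f g : ℕ → ℕ} → (∀ m → f m ≡ g m) → sumTo N f ≡ sumTo N g
sumTo-cong zero    f≗g = f≗g 0
sumTo-cong (suc N) f≗g = cong₂ _+_ (sumTo-cong N f≗g) (f≗g (suc N))

sumTo-+ : ∀ N (f g : ℕ → ℕ) → sumTo N (λ m → f m + g m) ≡ sumTo N f + sumTo N g
sumTo-+ zero    f g = refl
sumTo-+ (suc N) f g = begin
  sumTo N (λ m → f m + g m) + (f (suc N) + g (suc N))
    ≡⟨ cong (_+ (f (suc N) + g (suc N))) (sumTo-+ N f g) ⟩
  sumTo N f + sumTo N g + (f (suc N) + g (suc N))
    ≡⟨ +-*-Solver.solve 4 (λ a b c d → (a :+ b) :+ (c :+ d) := (a :+ c) :+ (b :+ d)) refl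
         (sumTo N f) (sumTo N g) (f (suc N)) (g (suc N)) ⟩
  sumTo N f + f (suc N) + (sumTo N g + g (suc N)) ∎
  where open +-*-Solver

sumTo-*ˡ : ∀ N c (f : ℕ → ℕ) → sumTo N (λ m → c * f m) ≡ c * sumTo N f
sumTo-*ˡ zero    c f = refl
sumTo-*ˡ (suc N) c f =
  trans (cong (_+ c * f (suc N)) (sumTo-*ˡ N c f)) (sym (*-distribˡ-+ c _ _))

sumTo-comm : ∀ N K (a : ℕ → ℕ → ℕ) →
  sumTo N (λ m → sumTo K (a m)) ≡ sumTo K (λ d → sumTo N (λ m → a m d))
sumTo-comm zero    K a = refl
sumTo-comm (suc N) K a =
  trans (cong (_+ sumTo K (a (suc N))) (sumTo-comm N K a))
        (sym (sumTo-+ K (λ d → sumTo N (λ m → a m d)) (a (suc N))))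

sumTo-suc : ∀ N (f : ℕ → ℕ) → sumTo (suc N) f ≡ f 0 + sumTo N (λ m → f (suc m))
sumTo-suc zero    f = refl
sumTo-suc (suc N) f = trans (cong (_+ f (suc (suc N))) (sumTo-suc N f)) (+-assoc (f 0) _ _)

sumTo-head : ∀ N (f : ℕ → ℕ) → (∀ m → f (suc m) ≡ 0) → sumTo N f ≡ f 0
sumTo-head zero    f tail≡0 = refl
sumTo-head (suc N) f tail≡0 =
  trans (cong₂ _+_ (sumTo-head N f tail≡0) (tail≡0 N)) (+-identityʳ (f 0))

sumTo-zero : ∀ N → sumTo N (λ _ → 0) ≡ 0
sumTo-zero N = sumTo-head N (λ _ → 0) (λ _ → refl)

sumTo-single : ∀ N h (f : ℕ → ℕ) → (∀ m → m ≢ h → f m ≡ 0) → h ≤ N → sumTo N f ≡ f h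
sumTo-single zero    zero    f off z≤n = refl
sumTo-single (suc N) zero    f off z≤n = begin
  sumTo (suc N) f                    ≡⟨ sumTo-suc N f ⟩
  f 0 + sumTo N (λ m → f (suc m))    ≡⟨ cong (_+_ (f 0)) (sumTo-cong N (λ m → off (suc m) (λ ()))) ⟩
  f 0 + sumTo N (λ _ → 0)            ≡⟨ cong (_+_ (f 0)) (sumTo-zero N) ⟩
  f 0 + 0                            ≡⟨ +-identityʳ (f 0) ⟩
  f 0                                ∎
sumTo-single (suc N) (suc h) f off (s≤s h≤N) = begin
  sumTo (suc N) f                    ≡⟨ sumTo-suc N f ⟩
  f 0 + sumTo N (λ m → f (suc m))    ≡⟨ cong₂ _+_ (off 0 (λ ())) (sumTo-single N h _ (λ m m≢h → off (suc m) (m≢h ∘ suc-injective)) h≤N) ⟩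
  f (suc h)                          ∎

sumTo-pascal : ∀ K r (g : ℕ → ℕ) → r < K →
  sumTo K (λ d → (suc r C d) * g d) ≡ sumTo K (λ d → (r C d) * g d) + sumTo K (λ d → (r C d) * g (suc d))
sumTo-pascal (suc K) r g (s≤s r≤K) = begin
  sumTo (suc K) (λ d → (suc r C d) * g d)                       ≡⟨ sumTo-suc K _ ⟩
  1 * g 0 + sumTo K (λ d → (suc r C suc d) * g (suc d))
    ≡⟨ cong (_+_ (1 * g 0)) (sumTo-cong K (λ d →
         trans (cong (_* g (suc d)) (sym (nCk+nC[k+1]≡[n+1]C[k+1] r d))) (*-distribʳ-+ (g (suc d)) (r C d) _))) ⟩
  1 * g 0 + sumTo K (λ d → (r C d) * g (suc d) + (r C suc d) * g (suc d))
    ≡⟨ cong (_+_ (1 * g 0)) (sumTo-+ K _ _) ⟩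
  1 * g 0 + (X + Y)                                             ≡⟨ cong (_+_ (1 * g 0)) (+-comm X Y) ⟩
  1 * g 0 + (Y + X)                                             ≡⟨ sym (+-assoc (1 * g 0) Y X) ⟩
  (1 * g 0 + Y) + X                                             ≡⟨ cong₂ _+_ (sym (sumTo-suc K _)) X≡X+0 ⟩
  sumTo (suc K) (λ d → (r C d) * g d) + sumTo (suc K) (λ d → (r C d) * g (suc d)) ∎
  where
  X Y : ℕ
  X = sumTo K (λ d → (r C d) * g (suc d))
  Y = sumTo K (λ d → (r C suc d) * g (suc d))
  X≡X+0 : X ≡ X + (r C suc K) * g (suc (suc K))
  X≡X+0 = sym (trans (cong (λ z → X + z * g (suc (suc K))) (k>n⇒nCk≡0 (s≤s r≤K))) (+-identityʳ X))

sum-tabulate : ∀ N (f : ℕ → ℕ) → sum (tabulate {n = suc N} (λ i → f (toℕ i))) ≡ sumTo N f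
sum-tabulate zero    f = +-identityʳ (f 0)
sum-tabulate (suc N) f =
  trans (cong (_+_ (f 0)) (sum-tabulate N (λ m → f (suc m)))) (sym (sumTo-suc N f))

sum-map-*ˡ : ∀ {A : Set} c (f : A → ℕ) xs → sum (map (λ x → c * f x) xs) ≡ c * sum (map f xs)
sum-map-*ˡ c f []       = sym (*-zeroʳ c)
sum-map-*ˡ c f (x ∷ xs) = trans (cong (_+_ (c * f x)) (sum-map-*ˡ c f xs)) (sym (*-distribˡ-+ c (f x) _))

sum-map-zero : ∀ {A : Set} (xs : List A) → sum (map (λ _ → 0) xs) ≡ 0
sum-map-zero []       = refl
sum-map-zero (x ∷ xs) = sum-map-zero xs

sum-map-if-* : ∀ {A : Set} b c (g : A → ℕ) ws →
  sum (map (λ w → if b then c * g w else 0) ws) ≡ (if b then c * sum (map g ws) else 0)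
sum-map-if-* true  c g ws = sum-map-*ˡ c g ws
sum-map-if-* false c g ws = sum-map-zero ws

sum-map-if-∧ : ∀ {A : Set} b (v : A → Bool) ws →
  sum (map (λ w → if b ∧ v w then 1 else 0) ws) ≡ (if b then sum (map (λ w → if v w then 1 else 0) ws) else 0)
sum-map-if-∧ true  v ws = refl
sum-map-if-∧ false v ws = sum-map-zero ws

sum-map-concatMap : ∀ {A B : Set} (f : B → ℕ) (g : A → List B) xs →
  sum (map f (concatMap g xs)) ≡ sum (map (λ x → sum (map f (g x))) xs)
sum-map-concatMap f g []       = refl
sum-map-concatMap f g (x ∷ xs) = begin
  sum (map f (g x ++ concatMap g xs))
    ≡⟨ cong sum (map-++ f (g x) (concatMap g xs)) ⟩
  sum (map f (g x) ++ map f (concatMap g xs))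
    ≡⟨ sum-++ (map f (g x)) _ ⟩
  sum (map f (g x)) + sum (map f (concatMap g xs))
    ≡⟨ cong (_+_ (sum (map f (g x)))) (sum-map-concatMap f g xs) ⟩
  sum (map f (g x)) + sum (map (λ x → sum (map f (g x))) xs) ∎

sum-allWords-suc : ∀ {A : Set} (f : List A → ℕ) as L →
  sum (map f (allWords as (suc L))) ≡ sum (map (λ a → sum (map (λ w → f (a ∷ w)) (allWords as L))) as)
sum-allWords-suc f as L =
  trans (sum-map-concatMap f _ as) (cong sum (map-cong (λ a → cong sum (sym (map-∘ (allWords as L)))) as))

≤ᵇ-true : ∀ {x y : ℤ} → x ℤ.≤ y → (x ℤ.≤ᵇ y) ≡ true
≤ᵇ-true x≤y = Equivalence.to T-≡ (ℤ.≤⇒≤ᵇ x≤y)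

-- F extended by zero to negative arguments, evaluated at x − d.
_⟨_-_⟩ : (ℕ → ℕ) → ℕ → ℕ → ℕ
F ⟨ x     - zero  ⟩ = F x
F ⟨ zero  - suc d ⟩ = 0
F ⟨ suc x - suc d ⟩ = F ⟨ x - d ⟩

⟨-⟩-cong : ∀ {F G : ℕ → ℕ} x d → (∀ y → F y ≡ G y) → F ⟨ x - d ⟩ ≡ G ⟨ x - d ⟩
⟨-⟩-cong x       zero    F≗G = F≗G x
⟨-⟩-cong zero    (suc d) F≗G = refl
⟨-⟩-cong (suc x) (suc d) F≗G = ⟨-⟩-cong x d F≗G

⟨-⟩-*ˡ : ∀ c (F : ℕ → ℕ) x d → (λ y → c * F y) ⟨ x - d ⟩ ≡ c * F ⟨ x - d ⟩
⟨-⟩-*ˡ c F x       zero    = refl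
⟨-⟩-*ˡ c F zero    (suc d) = sym (*-zeroʳ c)
⟨-⟩-*ˡ c F (suc x) (suc d) = ⟨-⟩-*ˡ c F x d

⟨-⟩-sumTo : ∀ N (F : ℕ → ℕ → ℕ) x d →
  sumTo N (λ m → F m ⟨ x - d ⟩) ≡ (λ y → sumTo N (λ m → F m y)) ⟨ x - d ⟩
⟨-⟩-sumTo N F x       zero    = refl
⟨-⟩-sumTo N F zero    (suc d) = sumTo-zero N
⟨-⟩-sumTo N F (suc x) (suc d) = ⟨-⟩-sumTo N F x d

⟨-⟩-prefixSum : ∀ {A B : ℕ → ℕ} x d → (∀ y → y ≤ suc x → A y ≡ sumTo y B) →
  A ⟨ suc x - d ⟩ ≡ A ⟨ x - d ⟩ + B ⟨ suc x - d ⟩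
⟨-⟩-prefixSum x zero A≡ΣB rewrite A≡ΣB (suc x) ≤-refl | A≡ΣB x (n≤1+n x) = refl
⟨-⟩-prefixSum zero    (suc zero)    A≡ΣB = A≡ΣB 0 z≤n
⟨-⟩-prefixSum zero    (suc (suc d)) A≡ΣB = refl
⟨-⟩-prefixSum (suc x) (suc d)       A≡ΣB = ⟨-⟩-prefixSum x d (λ y y≤ → A≡ΣB y (m≤n⇒m≤1+n y≤))

⟨-⟩-⊖ : ∀ (g : ℤ → ℕ) x d → (if + 0 ℤ.≤ᵇ x ⊖ d then g (x ⊖ d) else 0) ≡ (λ y → g (+ y)) ⟨ x - d ⟩
⟨-⟩-⊖ g x       zero    = refl
⟨-⟩-⊖ g zero    (suc d) = refl
⟨-⟩-⊖ g (suc x) (suc d) =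
  trans (cong (λ z → if + 0 ℤ.≤ᵇ z then g z else 0) (ℤ.[1+m]⊖[1+n]≡m⊖n x d)) (⟨-⟩-⊖ g x d)

conv : ℕ → (ℕ → ℕ) → (ℕ → ℕ) → ℕ → ℕ
conv K c F x = sumTo K (λ d → c d * F ⟨ x - d ⟩)

conv-sumTo : ∀ K c N (F : ℕ → ℕ → ℕ) x →
  sumTo N (λ m → conv K c (F m) x) ≡ conv K c (λ y → sumTo N (λ m → F m y)) x
conv-sumTo K c N F x = begin
  sumTo N (λ m → sumTo K (λ d → c d * F m ⟨ x - d ⟩))   ≡⟨ sumTo-comm N K _ ⟩
  sumTo K (λ d → sumTo N (λ m → c d * F m ⟨ x - d ⟩))   ≡⟨ sumTo-cong K (λ d → sumTo-*ˡ N (c d) _) ⟩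
  sumTo K (λ d → c d * sumTo N (λ m → F m ⟨ x - d ⟩))   ≡⟨ sumTo-cong K (λ d → cong (c d *_) (⟨-⟩-sumTo N F x d)) ⟩
  conv K c (λ y → sumTo N (λ m → F m y)) x              ∎

conv-prefixSum : ∀ K c {A B : ℕ → ℕ} x → (∀ y → y ≤ x → A y ≡ sumTo y B) →
  conv K c A x ≡ sumTo x (conv K c B)
conv-prefixSum K c {A} {B} zero A≡ΣB = sumTo-cong K (λ d → cong (c d *_) (at0 d))
  where
  at0 : ∀ d → A ⟨ 0 - d ⟩ ≡ B ⟨ 0 - d ⟩
  at0 zero    = A≡ΣB 0 z≤n
  at0 (suc d) = refl
conv-prefixSum K c {A} {B} (suc x) A≡ΣB = begin
  conv K c A (suc x)
    ≡⟨ sumTo-cong K (λ d → trans (cong (c d *_) (⟨-⟩-prefixSum x d A≡ΣB)) (*-distribˡ-+ (c d) _ _)) ⟩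
  sumTo K (λ d → c d * A ⟨ x - d ⟩ + c d * B ⟨ suc x - d ⟩)
    ≡⟨ sumTo-+ K _ _ ⟩
  conv K c A x + conv K c B (suc x)
    ≡⟨ cong (_+ conv K c B (suc x)) (conv-prefixSum K c x (λ y y≤ → A≡ΣB y (m≤n⇒m≤1+n y≤))) ⟩
  sumTo x (conv K c B) + conv K c B (suc x) ∎

restrict₀ : (ℕ → ℕ) → ℕ → ℕ
restrict₀ B zero    = B 0
restrict₀ B (suc h) = 0

sumTo-conv-suc : ∀ K c (B : ℕ → ℕ) → c 0 ≡ 1 → ∀ h →
  sumTo (suc h) (conv K c B) ≡ sumTo h (λ y → conv K c B (suc y) + restrict₀ B y)
sumTo-conv-suc K c B c0≡1 h = begin
  sumTo (suc h) (conv K c B)     ≡⟨ sumTo-suc h _ ⟩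
  conv K c B 0 + S               ≡⟨ cong (_+ S) conv-at-0 ⟩
  B 0 + S                        ≡⟨ +-comm (B 0) S ⟩
  S + B 0                        ≡⟨ cong (_+_ S) (sym (sumTo-head h (restrict₀ B) (λ _ → refl))) ⟩
  S + sumTo h (restrict₀ B)      ≡⟨ sym (sumTo-+ h _ _) ⟩
  sumTo h (λ y → conv K c B (suc y) + restrict₀ B y) ∎
  where
  S : ℕ
  S = sumTo h (λ y → conv K c B (suc y))
  conv-at-0 : conv K c B 0 ≡ B 0
  conv-at-0 = begin
    conv K c B 0  ≡⟨ sumTo-head K _ (λ d → *-zeroʳ (c (suc d))) ⟩
    c 0 * B 0     ≡⟨ cong (_* B 0) c0≡1 ⟩
    1 * B 0       ≡⟨ *-identityˡ (B 0) ⟩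
    B 0           ∎

prefixSum-iterate : ∀ K c N (A B : ℕ → ℕ → ℕ) → c 0 ≡ 1 →
  (∀ n h → A (suc n) h ≡ conv K c (A n) (suc h)) →
  (∀ n h → B (suc n) h ≡ conv K c (B n) (suc h) + restrict₀ (B n) h) →
  (∀ h → h ≤ N → A 0 h ≡ sumTo h (B 0)) →
  ∀ n h → h + n ≤ N → A n h ≡ sumTo h (B n)
prefixSum-iterate K c N A B c0≡1 stepA stepB base zero h h+0≤N =
  base h (subst (_≤ N) (+-identityʳ h) h+0≤N)
prefixSum-iterate K c N A B c0≡1 stepA stepB base (suc n) h h+1+n≤N = begin
  A (suc n) h                                           ≡⟨ stepA n h ⟩
  conv K c (A n) (suc h)                                ≡⟨ conv-prefixSum K c (suc h) A≡ΣB ⟩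
  sumTo (suc h) (conv K c (B n))                        ≡⟨ sumTo-conv-suc K c (B n) c0≡1 h ⟩
  sumTo h (λ y → conv K c (B n) (suc y) + restrict₀ (B n) y) ≡⟨ sumTo-cong h (λ y → sym (stepB n y)) ⟩
  sumTo h (B (suc n))                                   ∎
  where
  A≡ΣB : ∀ y → y ≤ suc h → A n y ≡ sumTo y (B n)
  A≡ΣB y y≤ = prefixSum-iterate K c N A B c0≡1 stepA stepB base n y
    (≤-trans (+-monoˡ-≤ n y≤) (subst (_≤ N) (+-suc h n) h+1+n≤N))

module UpDownPaths (j : ℕ) where

  k : ℕ
  k = suc (suc j)

  paths : ℕ → ℤ → ℤ → ℕ
  paths L x t = sum (map (λ w → if dValid k (suc j) x t w then 1 else 0) (allWords dSteps L))

  afterStep : ℕ → ℤ → ℤ → DStep → ℕ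
  afterStep L x t s = if -[1+ j ] ℤ.≤ᵇ dMove k s x then paths L (dMove k s x) t else 0

  paths-suc : ∀ L x t → paths (suc L) x t ≡ afterStep L x t up + afterStep L x t down
  paths-suc L x t = trans (sum-allWords-suc _ dSteps L)
    (cong₂ _+_ (viaStep up) (trans (+-identityʳ _) (viaStep down)))
    where
    viaStep : ∀ s → sum (map (λ w → if dValid k (suc j) x t (s ∷ w) then 1 else 0) (allWords dSteps L))
                    ≡ afterStep L x t s
    viaStep s = sum-map-if-∧ (-[1+ j ] ℤ.≤ᵇ dMove k s x) (dValid k (suc j) (dMove k s x) t) (allWords dSteps L)

  afterStep-valid : ∀ L x t s {z} → dMove k s x ≡ z → (-[1+ j ] ℤ.≤ᵇ z) ≡ true →
    afterStep L x t s ≡ paths L z t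
  afterStep-valid L x t s refl valid rewrite valid = refl

  afterStep-invalid : ∀ L x t s {z} → dMove k s x ≡ z → (-[1+ j ] ℤ.≤ᵇ z) ≡ false →
    afterStep L x t s ≡ 0
  afterStep-invalid L x t s refl invalid rewrite invalid = refl

  ⊖-valid : ∀ m {r} → r ≤ suc j → (-[1+ j ] ℤ.≤ᵇ m ⊖ r) ≡ true
  ⊖-valid m r≤1+j = ≤ᵇ-true (ℤ.≤-trans (ℤ.-[1+m]≤n⊖m+1 j m) (ℤ.⊖-monoʳ-≥-≤ m r≤1+j))

  up-⊖ : ∀ m r → dMove k up (m ⊖ suc r) ≡ m ⊖ r
  up-⊖ m r = begin
    (m ⊖ suc r) ℤ.+ + 1  ≡⟨ ℤ.distribˡ-⊖-+-pos 1 m (suc r) ⟩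
    (m + 1) ⊖ suc r      ≡⟨ cong (_⊖ suc r) (+-comm m 1) ⟩
    suc m ⊖ suc r        ≡⟨ ℤ.[1+m]⊖[1+n]≡m⊖n m r ⟩
    m ⊖ r                ∎

  down-⊖ : ∀ c r → dMove k down (k * suc c ⊖ suc r) ≡ k * c ⊖ r
  down-⊖ c r = begin
    (k * suc c ⊖ suc r) ℤ.+ -[1+ j ]  ≡⟨ ℤ.distribˡ-⊖-+-neg j (k * suc c) (suc r) ⟩
    k * suc c ⊖ (suc (suc r) + j)     ≡⟨ cong₂ _⊖_ (*-suc k c) (cong (suc ∘ suc) (+-comm r j)) ⟩
    (k + k * c) ⊖ (k + r)             ≡⟨ ℤ.+-cancelˡ-⊖ k (k * c) r ⟩
    k * c ⊖ r                         ∎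

  pathsFromLevel : ℕ → ℤ → ℕ → ℕ
  pathsFromLevel L t y = paths L (+ (k * y)) t

  -- The last r steps of a block, started at height k c − r: if d of them are down steps the block
  -- ends at height k (c − d), and when c − d ≥ 0 all (r C d) orders stay weakly above −(k − 1).
  paths-blockSuffix : ∀ L t r c → r ≤ k → paths (r + L) (k * c ⊖ r) t ≡ conv k (r C_) (pathsFromLevel L t) c
  paths-blockSuffix L t zero c _ =
    sym (trans (sumTo-head k _ (λ _ → refl)) (*-identityˡ _))
  paths-blockSuffix L t (suc r) c (s≤s r≤1+j) = begin
    paths (suc (r + L)) (k * c ⊖ suc r) t
      ≡⟨ paths-suc (r + L) (k * c ⊖ suc r) t ⟩
    afterStep (r + L) (k * c ⊖ suc r) t up + afterStep (r + L) (k * c ⊖ suc r) t down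
      ≡⟨ cong₂ _+_ viaUp (viaDown c) ⟩
    conv k (r C_) (pathsFromLevel L t) c + sumTo k (λ d → (r C d) * pathsFromLevel L t ⟨ c - suc d ⟩)
      ≡⟨ sym (sumTo-pascal k r _ (s≤s r≤1+j)) ⟩
    conv k (suc r C_) (pathsFromLevel L t) c ∎
    where
    viaUp : afterStep (r + L) (k * c ⊖ suc r) t up ≡ conv k (r C_) (pathsFromLevel L t) c
    viaUp = trans (afterStep-valid (r + L) (k * c ⊖ suc r) t up (up-⊖ (k * c) r) (⊖-valid (k * c) r≤1+j))
                  (paths-blockSuffix L t r c (m≤n⇒m≤1+n r≤1+j))
    viaDown : ∀ c → afterStep (r + L) (k * c ⊖ suc r) t down
                    ≡ sumTo k (λ d → (r C d) * pathsFromLevel L t ⟨ c - suc d ⟩)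
    viaDown zero rewrite *-zeroʳ k = begin
      afterStep (r + L) (0 ⊖ suc r) t down
        ≡⟨ afterStep-invalid (r + L) (0 ⊖ suc r) t down refl (dec-false (suc (r + j) ≤? j) (<⇒≱ (s≤s (m≤n+m j r)))) ⟩
      0
        ≡⟨ sym (sumTo-zero k) ⟩
      sumTo k (λ _ → 0)
        ≡⟨ sumTo-cong k (λ d → sym (*-zeroʳ (r C d))) ⟩
      sumTo k (λ d → (r C d) * 0) ∎
    viaDown (suc c) =
      trans (afterStep-valid (r + L) (k * suc c ⊖ suc r) t down (down-⊖ c r) (⊖-valid (k * c) r≤1+j))
            (paths-blockSuffix L t r c (m≤n⇒m≤1+n r≤1+j))

  paths-block : ∀ L t h → paths (k + L) (+ (k * h)) t ≡ conv k (k C_) (pathsFromLevel L t) (suc h)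
  paths-block L t h = begin
    paths (k + L) (+ (k * h)) t          ≡⟨ cong (λ z → paths (k + L) z t) (sym kh≡k[1+h]⊖k) ⟩
    paths (k + L) (k * suc h ⊖ k) t      ≡⟨ paths-blockSuffix L t k (suc h) ≤-refl ⟩
    conv k (k C_) (pathsFromLevel L t) (suc h)  ∎
    where
    kh≡k[1+h]⊖k : k * suc h ⊖ k ≡ + (k * h)
    kh≡k[1+h]⊖k = begin
      k * suc h ⊖ k        ≡⟨ cong₂ _⊖_ (*-suc k h) (sym (+-identityʳ k)) ⟩
      (k + k * h) ⊖ (k + 0) ≡⟨ ℤ.+-cancelˡ-⊖ k (k * h) 0 ⟩
      + (k * h)            ∎

  endingBelow : ℕ → ℕ → ℕ → ℕ
  endingBelow N n h = sumTo N (λ m → paths (k * n) (+ (k * h)) (+ (k * m)))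

  endingBelow-suc : ∀ N n h → endingBelow N (suc n) h ≡ conv k (k C_) (endingBelow N n) (suc h)
  endingBelow-suc N n h = begin
    endingBelow N (suc n) h
      ≡⟨ sumTo-cong N (λ m → trans (cong (λ L → paths L (+ (k * h)) (+ (k * m))) (*-suc k n))
                                    (paths-block (k * n) (+ (k * m)) h)) ⟩
    sumTo N (λ m → conv k (k C_) (pathsFromLevel (k * n) (+ (k * m))) (suc h))
      ≡⟨ conv-sumTo k (k C_) N _ (suc h) ⟩
    conv k (k C_) (endingBelow N n) (suc h) ∎

  endingBelow-zero : ∀ N h → h ≤ N → endingBelow N 0 h ≡ 1
  endingBelow-zero N h h≤N rewrite *-zeroʳ k = trans (sumTo-single N h _ off h≤N) on
    where
    on : paths 0 (+ (k * h)) (+ (k * h)) ≡ 1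
    on = cong (λ b → (if b then 1 else 0) + 0) (dec-true (+ (k * h) ℤ.≟ + (k * h)) refl)
    off : ∀ m → m ≢ h → paths 0 (+ (k * h)) (+ (k * m)) ≡ 0
    off m m≢h = cong (λ b → (if b then 1 else 0) + 0) (dec-false (+ (k * h) ℤ.≟ + (k * m))
                  (λ kh≡km → m≢h (sym (*-cancelˡ-≡ h m k (ℤ.+-injective kh≡km)))))

module ColoredMotzkin (j : ℕ) where

  k ℓ : ℕ
  k = suc (suc j)
  ℓ = suc j

  colors : MStep ℓ → ℤ → ℕ
  colors = mColors ℓ (alphaVec' k) (alphaVec k)

  weighted : ℕ → ℤ → ℕ
  weighted n z = sum (map (mWeight ℓ (alphaVec' k) (alphaVec k) z (+ 0)) (allWords (mSteps ℓ) n))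

  toZero : ℕ → ℕ → ℕ
  toZero n h = weighted n (+ h)

  afterStep : ℕ → ℤ → MStep ℓ → ℕ
  afterStep n z s = if + 0 ℤ.≤ᵇ mMove ℓ s z then colors s (mMove ℓ s z) * weighted n (mMove ℓ s z) else 0

  weighted-suc : ∀ n z → weighted (suc n) z ≡ sum (map (afterStep n z) (mSteps ℓ))
  weighted-suc n z = trans (sum-allWords-suc _ (mSteps ℓ) n) (cong sum (map-cong viaStep (mSteps ℓ)))
    where
    viaStep : ∀ s → sum (map (λ w → mWeight ℓ (alphaVec' k) (alphaVec k) z (+ 0) (s ∷ w)) (allWords (mSteps ℓ) n))
                    ≡ afterStep n z s
    viaStep s = sum-map-if-* (+ 0 ℤ.≤ᵇ mMove ℓ s z) (colors s (mMove ℓ s z))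
                  (mWeight ℓ (alphaVec' k) (alphaVec k) (mMove ℓ s z) (+ 0)) (allWords (mSteps ℓ) n)

  afterStep-lowering : ∀ n h s d → mMove ℓ s (+ h) ≡ suc h ⊖ d →
    afterStep n (+ h) s ≡ (λ y → colors s (+ y) * toZero n y) ⟨ suc h - d ⟩
  afterStep-lowering n h s d move≡ rewrite move≡ = ⟨-⟩-⊖ (λ z → colors s z * weighted n z) (suc h) d

  afterStep-constColors : ∀ n h s d c → mMove ℓ s (+ h) ≡ suc h ⊖ d → (∀ y → colors s (+ y) ≡ c) →
    afterStep n (+ h) s ≡ c * toZero n ⟨ suc h - d ⟩
  afterStep-constColors n h s d c move≡ colors≡c = begin
    afterStep n (+ h) s                                  ≡⟨ afterStep-lowering n h s d move≡ ⟩
    (λ y → colors s (+ y) * toZero n y) ⟨ suc h - d ⟩    ≡⟨ ⟨-⟩-cong (suc h) d (λ y → cong (_* toZero n y) (colors≡c y)) ⟩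
    (λ y → c * toZero n y) ⟨ suc h - d ⟩                 ≡⟨ ⟨-⟩-*ˡ c (toZero n) (suc h) d ⟩
    c * toZero n ⟨ suc h - d ⟩                           ∎

  lower-⊖ : ∀ h x → + h ℤ.- + x ≡ suc h ⊖ suc x
  lower-⊖ h x = trans (ℤ.m-n≡m⊖n h x) (sym (ℤ.[1+m]⊖[1+n]≡m⊖n h x))

  toZero-suc : ∀ n h → toZero (suc n) h ≡ conv k (k C_) (toZero n) (suc h) + restrict₀ (toZero n) h
  toZero-suc n h = begin
    toZero (suc n) h
      ≡⟨ weighted-suc n (+ h) ⟩
    afterStep n (+ h) U + (afterStep n (+ h) Dl + sum (map (afterStep n (+ h)) (map Dc (allFin ℓ))))
      ≡⟨ cong₂ _+_ viaU (cong₂ _+_ viaDl viaDc) ⟩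
    f 0 + (f k + (sumTo j (λ d → f (suc d)) + restrict₀ (toZero n) h))
      ≡⟨ +-*-Solver.solve 4 (λ a b c e → a :+ (b :+ (c :+ e)) := (a :+ (c :+ b)) :+ e) refl
           (f 0) (f k) (sumTo j (λ d → f (suc d))) (restrict₀ (toZero n) h) ⟩
    (f 0 + sumTo (suc j) (λ d → f (suc d))) + restrict₀ (toZero n) h
      ≡⟨ cong (_+ restrict₀ (toZero n) h) (sym (sumTo-suc (suc j) f)) ⟩
    conv k (k C_) (toZero n) (suc h) + restrict₀ (toZero n) h ∎
    where
    open +-*-Solver
    f : ℕ → ℕ
    f d = (k C d) * toZero n ⟨ suc h - d ⟩

    viaU : afterStep n (+ h) U ≡ f 0
    viaU = afterStep-constColors n h U 0 1 (cong +_ (+-comm h 1)) (λ _ → refl)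

    viaDl : afterStep n (+ h) Dl ≡ f k
    viaDl = trans (afterStep-constColors n h Dl k 1 (lower-⊖ h ℓ) (λ _ → refl))
                  (cong (_* toZero n ⟨ suc h - k ⟩) (sym (nCn≡1 k)))

    viaDc-zero : afterStep n (+ h) (Dc Fin.zero) ≡ f 1 + restrict₀ (toZero n) h
    viaDc-zero = trans (afterStep-lowering n h (Dc Fin.zero) 1 (lower-⊖ h 0)) (extraColor h)
      where
      -- D₀ steps ending at height 0 have α'₀ = k + 1 = (k C 1) + 1 colors.
      extraColor : ∀ h → colors (Dc Fin.zero) (+ h) * toZero n h ≡ (k C 1) * toZero n h + restrict₀ (toZero n) h
      extraColor zero    = trans (+-comm (toZero n 0) (k * toZero n 0))
                                 (cong (λ c → c * toZero n 0 + toZero n 0) (sym (nC1≡n k)))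
      extraColor (suc h) = sym (+-identityʳ _)

    viaDc-suc : ∀ (i : Fin j) → afterStep n (+ h) (Dc (Fin.suc i)) ≡ f (suc (suc (toℕ i)))
    viaDc-suc i = afterStep-constColors n h (Dc (Fin.suc i)) (suc (suc (toℕ i))) (k C suc (suc (toℕ i)))
                    (lower-⊖ h (suc (toℕ i))) (λ y → if-eta (+ y ==ℤ + 0))

    viaDc : sum (map (afterStep n (+ h)) (map Dc (allFin ℓ))) ≡ sumTo j (λ d → f (suc d)) + restrict₀ (toZero n) h
    viaDc = begin
      sum (map (afterStep n (+ h)) (map Dc (allFin ℓ)))
        ≡⟨ cong sum (trans (sym (map-∘ (allFin ℓ))) (map-tabulate (λ i → i) (λ i → afterStep n (+ h) (Dc i)))) ⟩
      afterStep n (+ h) (Dc Fin.zero) + sum (tabulate {n = j} (λ i → afterStep n (+ h) (Dc (Fin.suc i))))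
        ≡⟨ cong₂ _+_ viaDc-zero (cong sum (tabulate-cong viaDc-suc)) ⟩
      (f 1 + restrict₀ (toZero n) h) + sum (tabulate {n = j} (λ i → f (suc (suc (toℕ i)))))
        ≡⟨ +-*-Solver.solve 3 (λ a e b → (a :+ e) :+ b := (a :+ b) :+ e) refl
             (f 1) (restrict₀ (toZero n) h) (sum (tabulate {n = j} (λ i → f (suc (suc (toℕ i)))))) ⟩
      sum (tabulate {n = ℓ} (λ i → f (suc (toℕ i)))) + restrict₀ (toZero n) h
        ≡⟨ cong (_+ restrict₀ (toZero n) h) (sum-tabulate j (λ d → f (suc d))) ⟩
      sumTo j (λ d → f (suc d)) + restrict₀ (toZero n) h ∎

  prefixSum-toZero-zero : ∀ h → sumTo h (toZero 0) ≡ 1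
  prefixSum-toZero-zero h = sumTo-head h (toZero 0) (λ _ → refl)

corollary3p4 : (k : ℕ) → 2 ≤ k → (n : ℕ) →
    sumTo n (λ m → D k (k ∸ 1) n m) ≡ M (k ∸ 1) n 0 (alphaVec' k) (alphaVec k)
corollary3p4 (suc (suc j)) (s≤s (s≤s z≤n)) n = begin
  sumTo n (λ m → D k (suc j) n m)
    ≡⟨ sumTo-cong n (λ m → cong (λ z → paths (k * n) (+ z) (+ (k * m))) (sym (*-zeroʳ k))) ⟩
  endingBelow n n 0
    ≡⟨ prefixSum-iterate k (k C_) n (endingBelow n) toZero refl (endingBelow-suc n) toZero-suc base n 0 ≤-refl ⟩
  toZero n 0 ∎
  where
  open UpDownPaths j
  open ColoredMotzkin j using (toZero; toZero-suc; prefixSum-toZero-zero)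
  base : ∀ h → h ≤ n → endingBelow n 0 h ≡ sumTo h (toZero 0)
  base h h≤n = trans (endingBelow-zero n h h≤n) (sym (prefixSum-toZero-zero h))
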